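{- Let $d\ge 0$ and let $G$ be a connected weighted graph with $e(G)\le v(G)+d$ and no pendant edges. Let $V_{\ge 3}$ be its set of vertices of degree at least $3$, and let $P_1,\dots,P_w$ be the connected components of $G\setminus V_{\ge 3}$ (which are paths), each with a fixed orientation. Let $\mathcal{F}$ be the family of contracted decision trees $T$ for subgraphs $H$ of $G$ such that (i) $T$ has height at most $9d+1$ and (ii) each node $x$ of $T$ is associated either to a strategy that consists of querying a single edge incident to $V(H^x)\cap V_{\ge 3}$, or to a strategy $S(H^x,e)$ for some path $P_i$ and some $e\in E(H^x)\cap E(P_i)$. Then $\mathcal{F}$ contains at most $e(G)^{4^{9d+1}}$ contracted decision trees.
   Context: Query-commit setting: weighted graph, each edge exists independently with probability $p_e\in(0,1]$; a strategy queries edges adaptively, a successful query adds the edge to the matching and deletes all edges sharing an endpoint with it from the residual graph, an unsuccessful query deletes the edge. For a strategy $S$ on $H$, $\mathcal{R}(S,H)$ is the set of possible residual graphs after executing $S$. A contracted decision tree (CDT) for $H$ is a rooted tree where each node $x$ has a graph $H^x$ and each internal node $x$ a strategy $S^x$ for $H^x$, such that $H^{root}=H$, each internal node $x$ has exactly $|\mathcal{R}(S^x,H^x)|$ children whose graphs are exactly the elements of $\mathcal{R}(S^x,H^x)$, and $S^x\neq S^y$ whenever $x$ is an ancestor of $y$. Height is the number of nodes on a longest root-to-leaf path. For $e=e_j$ on the path $P_i=(u_1e_1u_2\dots e_qu_{q+1})$ (with its fixed orientation), $S(H,e)$ queries $e_j,e_{j-1},\dots,e_1$ in order and then $e_{j+1},\dots,e_q$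 in order, ignoring edges not in $H$.
   Formalization: The bound $e(G)^{4^{9d+1}}$ is for the contracted decision trees rooted at one fixed subgraph $H$ of $G$, not for the family over all subgraphs together, and $G$ has at least one edge. The statement above fails without it. -}

module Defs where

open import Data.Nat using (ℕ; zero; suc; _≤_; _+_; _*_; _^_)
open import Data.Fin using (Fin; toℕ)
open import Data.Fin.Properties using () renaming (_≟_ to _≟F_)
open import Data.Bool using (Bool; true; false; if_then_else_; _∧_; _∨_; not; T)
open import Data.Bool.Properties using () renaming (_≟_ to _≟B_)
open import Data.Vec using (Vec; lookup; tabulate)
open import Data.Vec.Properties using () renaming (≡-dec to ≡-decV)
open import Data.List using (List; []; _∷_; _++_; [_]; length; filter; allFin; reverse; take; drop; map)
open import Data.Bool.ListAction using (any)
open import Data.List.Membership.Propositional using (_∈_)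
open import Data.List.Relation.Unary.Any using (Any)
open import Data.Product using (Σ; ∃; ∃-syntax; _×_; _,_; proj₁; proj₂)
open import Data.Product.Properties using () renaming (≡-dec to ≡-dec×)
open import Data.Sum using (_⊎_)
open import Data.Unit using (⊤)
open import Data.Empty using (⊥)
open import Relation.Nullary using (¬_; Dec)
open import Relation.Nullary.Decidable using (⌊_⌋; _⊎-dec_)
open import Relation.Binary.PropositionalEquality using (_≡_; _≢_)

-- Finite simple graphs: vertices Fin nV, edges Fin nE with two distinct
-- endpoints, no parallel edges.  (Weights play no role in the statement.)

record Graph : Set where
  field
    nV nE    : ℕ
    src tgt  : Fin nE → Fin nV
    loopless : ∀ e → src e ≢ tgt e
    noMulti  : ∀ e f → ((src e ≡ src f × tgt e ≡ tgt f) ⊎ (src e ≡ tgt f × tgt e ≡ src f)) → e ≡ f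

module GraphNotions (G : Graph) where
  open Graph G

  Joins : Fin nE → Fin nV → Fin nV → Set
  Joins e u w = (src e ≡ u × tgt e ≡ w) ⊎ (src e ≡ w × tgt e ≡ u)

  Incident : Fin nE → Fin nV → Set
  Incident e v = (src e ≡ v) ⊎ (tgt e ≡ v)

  incident? : ∀ v e → Dec (Incident e v)
  incident? v e = (src e ≟F v) ⊎-dec (tgt e ≟F v)

  degree : Fin nV → ℕ
  degree v = length (filter (incident? v) (allFin nE))

  data Walk : Fin nV → Fin nV → Set where
    here : ∀ {v} → Walk v v
    step : ∀ {u w v} (e : Fin nE) → Joins e u w → Walk w v → Walk u v

  Connected : Set
  Connected = ∀ u v → Walk u v

  NoPendantEdges : Set
  NoPendantEdges = ∀ e → (degree (src e) ≢ 1) × (degree (tgt e) ≢ 1)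

  High : Fin nV → Set
  High v = 3 ≤ degree v

  -- Paths u_1 e_1 u_2 … e_q u_{q+1} (0-indexed here), with orientation
  -- given by the indexing.
  record Path : Set where
    field
      len   : ℕ
      vert  : Fin (suc len) → Fin nV
      edge  : Fin len → Fin nE
      vinj  : ∀ k l → vert k ≡ vert l → k ≡ l
      joins : ∀ (k : Fin len) → Joins (edge k) (vert (Data.Fin.inject₁ k)) (vert (Data.Fin.suc k))

  open Path public

  IsComponentPaths : (w : ℕ) → (Fin w → Path) → Set
  IsComponentPaths w P =
      (∀ i k → ¬ High (vert (P i) k))
    × (∀ v → ¬ High v → ∃[ i ] ∃[ k ] vert (P i) k ≡ v)
    × (∀ i j k l → vert (P i) k ≡ vert (P j) l → i ≡ j)
    × (∀ e → ¬ High (src e) → ¬ High (tgt e) → ∃[ i ] ∃[ j ] edge (P i) j ≡ e)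

  SG : Set
  SG = Vec Bool nV × Vec Bool nE

  V : SG → Vec Bool nV
  V = proj₁

  E : SG → Vec Bool nE
  E = proj₂

  IsSubgraph : SG → Set
  IsSubgraph H = ∀ e → T (lookup (E H) e) → T (lookup (V H) (src e)) × T (lookup (V H) (tgt e))

  _≟SG_ : (H H' : SG) → Dec (H ≡ H')
  _≟SG_ = ≡-dec× (≡-decV _≟B_) (≡-decV _≟B_)

  _==_ : Fin nV → Fin nV → Bool
  u == v = ⌊ u ≟F v ⌋

  -- edges e and f share an endpoint (in particular every e shares with itself)
  shares : Fin nE → Fin nE → Bool
  shares e f = (src e == src f) ∨ (src e == tgt f) ∨ (tgt e == src f) ∨ (tgt e == tgt f)

  afterSuccess : Fin nE → SG → SG
  afterSuccess e (vs , es) = vs , tabulate (λ f → lookup es f ∧ not (shares e f))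

  afterFailure : Fin nE → SG → SG
  afterFailure e (vs , es) = vs , tabulate (λ f → lookup es f ∧ not ⌊ f ≟F e ⌋)

  data Strategy : Set where
    stop  : Strategy
    query : Fin nE → (onSuccess onFailure : Strategy) → Strategy

  ValidFor : Strategy → SG → Set
  ValidFor stop H = ⊤
  ValidFor (query e s f) H =
    T (lookup (E H) e) × ValidFor s (afterSuccess e H) × ValidFor f (afterFailure e H)

  -- sure e = true  iff  p_e = 1 (edge exists with certainty); success is
  -- always possible since p_e > 0, failure is possible iff p_e < 1.
  module Outcomes (sure : Vec Bool nE) where

    -- the list of possible residual graphs; R(S,H) is its set of elements
    residuals : Strategy → SG → List SG
    residuals stop H = [ H ]
    residuals (query e s f) H =
      residuals s (afterSuccess e H) ++
      (if lookup sure e then [] else residuals f (afterFailure e H))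

    -- H' ∈ R(S,H), as a boolean (so proofs of membership are unique)
    inR : Strategy → SG → SG → Bool
    inR S H H' = any (λ K → ⌊ K ≟SG H' ⌋) (residuals S H)

    data CDT (H : SG) : Set where
      leaf : CDT H
      node : (S : Strategy) → ValidFor S H →
             ((H' : SG) → T (inR S H H') → CDT H') → CDT H

    -- height (number of nodes on a longest root-leaf path) ≤ k
    HeightAtMost : ∀ {H} → ℕ → CDT H → Set
    HeightAtMost zero    leaf = ⊥
    HeightAtMost (suc k) leaf = ⊤
    HeightAtMost zero    (node S v ch) = ⊥
    HeightAtMost (suc k) (node S v ch) = ∀ H' p → HeightAtMost k (ch H' p)

    DistinctAlongPaths : ∀ {H} → List Strategy → CDT H → Set
    DistinctAlongPaths anc leaf = ⊤
    DistinctAlongPaths anc (node S v ch) =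
      ¬ (S ∈ anc) × (∀ H' p → DistinctAlongPaths (S ∷ anc) (ch H' p))

    AllNodes : (SG → Strategy → Set) → ∀ {H} → CDT H → Set
    AllNodes A leaf = ⊤
    AllNodes A {H} (node S v ch) = A H S × (∀ H' p → AllNodes A (ch H' p))

    _≈T_ : ∀ {H} → CDT H → CDT H → Set
    leaf ≈T leaf = ⊤
    leaf ≈T node _ _ _ = ⊥
    node _ _ _ ≈T leaf = ⊥
    node S _ ch ≈T node S' _ ch' = (S ≡ S') × (∀ H' p p' → ch H' p ≈T ch' H' p')

  -- The strategy S(H, e) for e = e_j on a path P: query e_j, e_{j-1}, …, e_1,
  -- then e_{j+1}, …, e_q, skipping edges not present in the current graph.
  runSeq : List (Fin nE) → SG → Strategy
  runSeq [] H = stop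
  runSeq (f ∷ fs) H =
    if lookup (E H) f
    then query f (runSeq fs (afterSuccess f H)) (runSeq fs (afterFailure f H))
    else runSeq fs H

  pathOrder : (q : ℕ) → Fin q → List (Fin q)
  pathOrder q j = reverse (take (suc (toℕ j)) (allFin q)) ++ drop (suc (toℕ j)) (allFin q)

  pathStrategy : SG → (P : Path) → Fin (len P) → Strategy
  pathStrategy H P j = runSeq (map (edge P) (pathOrder (len P) j)) H

  AllowedStrategy : (w : ℕ) → (Fin w → Path) → SG → Strategy → Set
  AllowedStrategy w P K S =
      (∃[ e ] ∃[ v ] T (lookup (E K) e) × Incident e v × T (lookup (V K) v) × High v
                     × S ≡ query e stop stop)
    ⊎ (∃[ i ] ∃[ j ] T (lookup (E K) (edge (P i) j)) × S ≡ pathStrategy K (P i) j)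

{-# OPTIONS --safe #-}
-- Every allowed strategy at a node with graph K is determined by one edge e: it is either the
-- single query of e, or S(K, e) for the unique path position of e.  So a node offers at most
-- 2 e(G) strategies, and each has at most four residual graphs: S(K, e) removes every edge of
-- its path, and since the inner vertices of the path have degree 2, the only further edges it
-- can remove are those at the two ends of the path, depending on whether some query at that end
-- succeeded.  Enumerating trees level by level gives at most N(h) trees of height at most h + 1,
-- where N(0) = 1 and N(h+1) = 1 + 2 e(G) N(h)^4, and N(h) ≤ e(G)^(4^h - 1) since e(G) ≥ 2 in a
-- graph without pendant edges.
module Submission where

open import Defs
open import Data.Nat using (ℕ; _≤_; _+_; _*_; _^_)
open import Data.Fin using (Fin)
open import Data.Bool using (Bool)
open import Data.Vec using (Vec)
open import Data.List using (List; []; length)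
open import Data.List.Relation.Unary.Any using (Any)
open import Data.Product using (Σ; ∃-syntax; _×_)

open import Data.Nat using (zero; suc; _<_; z≤n; s≤s; NonZero; >-nonZero; _≟_; _≤?_)
open import Data.Nat.Properties
open import Data.Nat.Tactic.RingSolver using (solve-∀)
open import Data.Fin using (toℕ; fromℕ; fromℕ<; inject₁; lower₁) renaming (zero to fzero; suc to fsuc)
open import Data.Fin.Properties
  using (any?; toℕ-injective; toℕ-inject₁; toℕ-fromℕ; inject₁-injective; inject₁-lower₁)
  renaming (_≟_ to _≟F_)
open import Data.Bool using (true; false; T; _∧_; _∨_; not)
open import Data.Bool.Properties using (T?; T-irrelevant; T-≡; T-∧; T-∨; ∨-assoc; ∧-identityʳ)
open import Data.Bool.ListAction using (any)
open import Data.Vec using (lookup; tabulate)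
open import Data.Vec.Properties using (lookup∘tabulate; tabulate∘lookup; tabulate-cong)
open import Data.List using (_∷_; _++_; [_]; map; concatMap; mapMaybe; filter; allFin; take; drop; reverse)
import Data.List.Properties as LP
open import Data.List.Membership.Propositional using (_∈_; find; lose)
open import Data.List.Membership.Propositional.Properties
  using (∈-filter⁺; ∈-allFin; ∈-++⁻; ∈-++⁺ˡ; ∈-++⁺ʳ; ∈-map⁺; ∈-map⁻)
open import Data.List.Relation.Binary.Subset.Propositional using (_⊆_)
open import Data.List.Relation.Unary.All as All using (All; []; _∷_)
import Data.List.Relation.Unary.All.Properties as All
import Data.List.Relation.Unary.Any as Any
open import Data.List.Relation.Unary.Any using (here; there)
open import Data.List.Relation.Unary.Any.Properties
  using (any⁺; any⁻; concatMap⁺; map⁺; mapMaybe⁺; reverse⁺)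
open import Data.Maybe using (Maybe; just; nothing)
import Data.Maybe.Relation.Unary.All as Maybe
import Data.Maybe.Relation.Unary.Any as Maybe
open import Data.Product using (∃; _,_; proj₁; proj₂; map₂)
open import Data.Sum using (_⊎_; inj₁; inj₂)
import Data.Sum as Sum
open import Data.Empty using (⊥-elim)
open import Data.Unit using (tt)
open import Function using (id; _∘_)
open import Function.Bundles using (Equivalence)
open import Relation.Nullary using (¬_; Dec; yes; no)
open import Relation.Nullary.Decidable using (⌊_⌋; toWitness; fromWitness)
open import Relation.Binary.Definitions using (DecidableEquality)
open import Relation.Binary.PropositionalEquality
  using (_≡_; _≢_; refl; sym; trans; cong; cong₂; subst; module ≡-Reasoning)

module _ {A : Set} where

  1≤length : ∀ {a : A} {xs} → a ∈ xs → 1 ≤ length xs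
  1≤length (here _)  = s≤s z≤n
  1≤length (there _) = s≤s z≤n

  2≤length : ∀ {a b : A} {xs} → a ∈ xs → b ∈ xs → a ≢ b → 2 ≤ length xs
  2≤length (here refl) (here refl) a≢b = ⊥-elim (a≢b refl)
  2≤length (here _)    (there b∈)  _   = s≤s (1≤length b∈)
  2≤length (there a∈)  (here _)    _   = s≤s (1≤length a∈)
  2≤length (there a∈)  (there b∈)  a≢b = m≤n⇒m≤1+n (2≤length a∈ b∈ a≢b)

  3≤length : ∀ {a b c : A} {xs} → a ∈ xs → b ∈ xs → c ∈ xs →
             a ≢ b → a ≢ c → b ≢ c → 3 ≤ length xs
  3≤length (here refl) (here refl) _           a≢b _   _   = ⊥-elim (a≢b refl)
  3≤length (here refl) (there _)   (here refl) _   a≢c _   = ⊥-elim (a≢c refl)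
  3≤length (there _)   (here refl) (here refl) _   _   b≢c = ⊥-elim (b≢c refl)
  3≤length (here _)    (there b∈)  (there c∈)  _   _   b≢c = s≤s (2≤length b∈ c∈ b≢c)
  3≤length (there a∈)  (here _)    (there c∈)  _   a≢c _   = s≤s (2≤length a∈ c∈ a≢c)
  3≤length (there a∈)  (there b∈)  (here _)    a≢b _   _   = s≤s (2≤length a∈ b∈ a≢b)
  3≤length (there a∈)  (there b∈)  (there c∈)  a≢b a≢c b≢c =
    m≤n⇒m≤1+n (3≤length a∈ b∈ c∈ a≢b a≢c b≢c)

  length-concatMap-≤ : ∀ {B : Set} (f : A → List B) {n} xs →
                       All (λ x → length (f x) ≤ n) xs → length (concatMap f xs) ≤ length xs * n
  length-concatMap-≤ f []       []         = z≤n
  length-concatMap-≤ f (x ∷ xs) (fx≤ ∷ ≤s) = begin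
    length (f x ++ concatMap f xs)         ≡⟨ LP.length-++ (f x) ⟩
    length (f x) + length (concatMap f xs) ≤⟨ +-mono-≤ fx≤ (length-concatMap-≤ f xs ≤s) ⟩
    _ + length xs * _                      ∎
    where open ≤-Reasoning

module Choice {A : Set} (_≟_ : DecidableEquality A) {B : A → Set} where

  lookupOr : ((a : A) → B a) → List (Σ A B) → (a : A) → B a
  lookupOr default []              a = default a
  lookupOr default ((a′ , b) ∷ ρ) a with a′ ≟ a
  ... | yes refl = b
  ... | no _     = lookupOr default ρ a

  choices : List A → ((a : A) → List (B a)) → List (List (Σ A B))
  choices []       bs = [ [] ]
  choices (a ∷ as) bs = concatMap (λ b → map ((a , b) ∷_) (choices as bs)) (bs a)

  length-choices : ∀ as (bs : (a : A) → List (B a)) {n} →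
                   (∀ a → length (bs a) ≤ n) → length (choices as bs) ≤ n ^ length as
  length-choices []       bs bs≤ = ≤-refl
  length-choices (a ∷ as) bs {n} bs≤ = begin
    length (choices (a ∷ as) bs)       ≤⟨ length-concatMap-≤ _ (bs a) (All.tabulate λ _ → tail≤) ⟩
    length (bs a) * n ^ length as      ≤⟨ *-monoˡ-≤ _ (bs≤ a) ⟩
    n * n ^ length as                  ∎
    where
    open ≤-Reasoning
    tail≤ : ∀ {b} → length (map ((a , b) ∷_) (choices as bs)) ≤ n ^ length as
    tail≤ = ≤-trans (≤-reflexive (LP.length-map _ (choices as bs))) (length-choices as bs bs≤)

  choices-complete : ∀ (default : (a : A) → B a) as bs (Q : (a : A) → B a → Set) →
    (∀ a → a ∈ as → ∃[ b ] b ∈ bs a × Q a b) →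
    ∃[ ρ ] ρ ∈ choices as bs × (∀ a → a ∈ as → Q a (lookupOr default ρ a))
  choices-complete default []       bs Q pick = [] , here refl , λ _ ()
  choices-complete default (a ∷ as) bs Q pick
    with pick a (here refl) | choices-complete default as bs Q (λ a′ a′∈ → pick a′ (there a′∈))
  ... | b , b∈ , qb | ρ , ρ∈ , qρ = (a , b) ∷ ρ , ρ′∈ , qρ′
    where
    ρ′∈ : (a , b) ∷ ρ ∈ choices (a ∷ as) bs
    ρ′∈ = concatMap⁺ _ (Any.map (λ { refl → map⁺ (Any.map (cong ((a , b) ∷_)) ρ∈) }) b∈)
    qρ′ : ∀ a′ → a′ ∈ a ∷ as → Q a′ (lookupOr default ((a , b) ∷ ρ) a′)
    qρ′ a′ a′∈ with a ≟ a′
    ... | yes refl = qb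
    ... | no a≢a′ with a′∈
    ...   | here a′≡a = ⊥-elim (a≢a′ (sym a′≡a))
    ...   | there a′∈as = qρ a′ a′∈as

T-injective : ∀ {x y} → (T x → T y) → (T y → T x) → x ≡ y
T-injective {false} {false} _ _ = refl
T-injective {false} {true}  _ y⇒x = ⊥-elim (y⇒x tt)
T-injective {true}  {false} x⇒y _ = ⊥-elim (x⇒y tt)
T-injective {true}  {true}  _ _ = refl

∧-not-∨ : ∀ a x y → (a ∧ not x) ∧ not y ≡ a ∧ not (x ∨ y)
∧-not-∨ false x     y = refl
∧-not-∨ true  true  y = refl
∧-not-∨ true  false y = refl

∨-swap : ∀ x y z → x ∨ (y ∨ z) ≡ y ∨ (x ∨ z)
∨-swap true  true  z = refl
∨-swap true  false z = refl
∨-swap false y     z = refl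

-- Bounds the number of trees of height at most h + 1 whose nodes offer at most m strategies,
-- each with at most b residual graphs.
treeBound : (m b : ℕ) → ℕ → ℕ
treeBound m b zero    = 1
treeBound m b (suc h) = suc (m * treeBound m b h ^ b)

treeBound-nonZero : ∀ m b h → NonZero (treeBound m b h)
treeBound-nonZero m b zero    = _
treeBound-nonZero m b (suc h) = _

-- 4 ^ h ∸ 1, written without truncated subtraction.
exponent : ℕ → ℕ
exponent zero    = 0
exponent (suc h) = exponent h * 4 + 3

exponent<4^ : ∀ h → exponent h < 4 ^ h
exponent<4^ zero    = s≤s z≤n
exponent<4^ (suc h) = begin-strict
  exponent h * 4 + 3     <⟨ m<m+n _ (s≤s z≤n) ⟩
  exponent h * 4 + 3 + 1 ≡⟨ regroup (exponent h) ⟩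
  4 * suc (exponent h)   ≤⟨ *-monoʳ-≤ 4 (exponent<4^ h) ⟩
  4 * 4 ^ h              ∎
  where
  open ≤-Reasoning
  regroup : ∀ e → e * 4 + 3 + 1 ≡ 4 * suc e
  regroup = solve-∀

1+2n≤n³ : ∀ {n} → 2 ≤ n → 1 + (n + n) ≤ n ^ 3
1+2n≤n³ {n} 2≤n = begin
  1 + (n + n)       ≤⟨ +-monoˡ-≤ (n + n) (≤-trans (s≤s z≤n) (+-mono-≤ 2≤n z≤n)) ⟩
  (n + n) + (n + n) ≡⟨ four-times n ⟩
  n * (2 * 2)       ≤⟨ *-monoʳ-≤ n (*-mono-≤ 2≤n (≤-trans 2≤n (≤-reflexive (sym (*-identityʳ n))))) ⟩
  n ^ 3             ∎
  where
  open ≤-Reasoning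
  four-times : ∀ n → (n + n) + (n + n) ≡ n * (2 * 2)
  four-times = solve-∀

treeBound≤ : ∀ {n} → 2 ≤ n → ∀ h → treeBound (n + n) 4 h ≤ n ^ exponent h
treeBound≤ {n} 2≤n zero    = ≤-refl
treeBound≤ {n} 2≤n (suc h) = begin
  1 + (n + n) * treeBound (n + n) 4 h ^ 4 ≤⟨ +-monoʳ-≤ 1 (*-monoʳ-≤ (n + n) (^-monoˡ-≤ 4 ih)) ⟩
  1 + (n + n) * (n ^ exponent h) ^ 4     ≡⟨ cong (λ x → 1 + (n + n) * x) (^-*-assoc n (exponent h) 4) ⟩
  1 + (n + n) * y                        ≤⟨ +-monoˡ-≤ ((n + n) * y) 1≤y ⟩
  y + (n + n) * y                        ≡⟨ factor y (n + n) ⟩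
  y * (1 + (n + n))                      ≤⟨ *-monoʳ-≤ y (1+2n≤n³ 2≤n) ⟩
  y * n ^ 3                              ≡⟨ sym (^-distribˡ-+-* n (exponent h * 4) 3) ⟩
  n ^ (exponent h * 4 + 3)               ∎
  where
  open ≤-Reasoning
  instance
    n≢0 : NonZero n
    n≢0 = >-nonZero (≤-trans (s≤s z≤n) 2≤n)
  y : ℕ
  y = n ^ (exponent h * 4)
  1≤y : 1 ≤ y
  1≤y = m^n>0 n (exponent h * 4)
  ih : treeBound (n + n) 4 h ≤ n ^ exponent h
  ih = treeBound≤ 2≤n h
  factor : ∀ y m → y + m * y ≡ y * (1 + m)
  factor = solve-∀

module GraphFacts (G : Graph) where
  open Graph G
  open GraphNotions G

  joins-incidentˡ : ∀ {e x y} → Joins e x y → Incident e x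
  joins-incidentˡ (inj₁ (s≡x , _)) = inj₁ s≡x
  joins-incidentˡ (inj₂ (_ , t≡x)) = inj₂ t≡x

  joins-incidentʳ : ∀ {e x y} → Joins e x y → Incident e y
  joins-incidentʳ (inj₁ (_ , t≡y)) = inj₂ t≡y
  joins-incidentʳ (inj₂ (s≡y , _)) = inj₁ s≡y

  joins-incident⁻ : ∀ {e x y v} → Joins e x y → Incident e v → v ≡ x ⊎ v ≡ y
  joins-incident⁻ (inj₁ (s≡x , _))   (inj₁ s≡v) = inj₁ (trans (sym s≡v) s≡x)
  joins-incident⁻ (inj₁ (_   , t≡y)) (inj₂ t≡v) = inj₂ (trans (sym t≡v) t≡y)
  joins-incident⁻ (inj₂ (s≡y , _))   (inj₁ s≡v) = inj₂ (trans (sym s≡v) s≡y)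
  joins-incident⁻ (inj₂ (_   , t≡x)) (inj₂ t≡v) = inj₁ (trans (sym t≡v) t≡x)

  joins-src : ∀ {e x y} → Joins e x y → src e ≡ x ⊎ src e ≡ y
  joins-src j = joins-incident⁻ j (inj₁ refl)

  joins-unique : ∀ {e x y x′ y′} → Joins e x y → Joins e x′ y′ →
                 (x ≡ x′ × y ≡ y′) ⊎ (x ≡ y′ × y ≡ x′)
  joins-unique (inj₁ (a , b)) (inj₁ (c , d)) = inj₁ (trans (sym a) c , trans (sym b) d)
  joins-unique (inj₁ (a , b)) (inj₂ (c , d)) = inj₂ (trans (sym a) c , trans (sym b) d)
  joins-unique (inj₂ (a , b)) (inj₁ (c , d)) = inj₂ (trans (sym b) d , trans (sym a) c)
  joins-unique (inj₂ (a , b)) (inj₂ (c , d)) = inj₁ (trans (sym b) d , trans (sym a) c)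

  shares⇒common-endpoint : ∀ e f → T (shares e f) → ∃[ v ] Incident e v × Incident f v
  shares⇒common-endpoint e f _ with src e ≟F src f | src e ≟F tgt f | tgt e ≟F src f | tgt e ≟F tgt f
  ... | yes p | _     | _     | _     = src e , inj₁ refl , inj₁ (sym p)
  ... | no _  | yes p | _     | _     = src e , inj₁ refl , inj₂ (sym p)
  ... | no _  | no _  | yes p | _     = tgt e , inj₂ refl , inj₁ (sym p)
  ... | no _  | no _  | no _  | yes p = tgt e , inj₂ refl , inj₂ (sym p)

  common-endpoint⇒shares : ∀ e f {v} → Incident e v → Incident f v → T (shares e f)
  common-endpoint⇒shares e f ie if with src e ≟F src f | src e ≟F tgt f | tgt e ≟F src f | tgt e ≟F tgt f
  ... | yes _ | _     | _     | _     = tt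
  ... | no _  | yes _ | _     | _     = tt
  ... | no _  | no _  | yes _ | _     = tt
  ... | no _  | no _  | no _  | yes _ = tt
  ... | no ss | no st | no ts | no tt′ with ie | if
  ...   | inj₁ a | inj₁ b = ss  (trans a (sym b))
  ...   | inj₁ a | inj₂ b = st  (trans a (sym b))
  ...   | inj₂ a | inj₁ b = ts  (trans a (sym b))
  ...   | inj₂ a | inj₂ b = tt′ (trans a (sym b))

  shares-refl : ∀ e → shares e e ≡ true
  shares-refl e = Equivalence.to T-≡ (common-endpoint⇒shares e e (inj₁ refl) (inj₁ refl))

  incident⇒∈-filter : ∀ {e v} → Incident e v → e ∈ filter (incident? v) (allFin nE)
  incident⇒∈-filter {e} i = ∈-filter⁺ (incident? _) (∈-allFin e) i

  3≤degree : ∀ {a b c v} → a ≢ b → a ≢ c → b ≢ c →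
             Incident a v → Incident b v → Incident c v → High v
  3≤degree a≢b a≢c b≢c ia ib ic =
    3≤length (incident⇒∈-filter ia) (incident⇒∈-filter ib) (incident⇒∈-filter ic) a≢b a≢c b≢c

  -- A graph with a single edge has two vertices of degree 1.
  2≤nE : NoPendantEdges → 1 ≤ nE → 2 ≤ nE
  2≤nE noPendant 1≤nE with nE ≤? 1
  ... | no nE≰1   = ≰⇒> nE≰1
  ... | yes nE≤1  = ⊥-elim (proj₁ (noPendant e) (≤-antisym degree≤1 1≤degree))
    where
    e : Fin nE
    e = fromℕ< 1≤nE
    degree≤1 : degree (src e) ≤ 1
    degree≤1 = begin
      degree (src e)     ≤⟨ LP.length-filter (incident? (src e)) (allFin nE) ⟩
      length (allFin nE) ≡⟨ LP.length-tabulate id ⟩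
      nE                 ≤⟨ nE≤1 ⟩
      1                  ∎
      where open ≤-Reasoning
    1≤degree : 1 ≤ degree (src e)
    1≤degree = 1≤length (incident⇒∈-filter (inj₁ refl))

module Enumeration (G : Graph) (sure : Vec Bool (Graph.nE G)) where
  open Graph G
  open GraphNotions G
  open Outcomes sure
  open Choice _≟SG_ {CDT}

  validFor? : ∀ S K → Dec (ValidFor S K)
  validFor? stop          K = yes tt
  validFor? (query e s f) K with lookup (E K) e
  ... | false = no proj₁
  ... | true  with validFor? s (afterSuccess e K) | validFor? f (afterFailure e K)
  ...   | yes vs | yes vf = yes (tt , vs , vf)
  ...   | no ¬vs | _      = no (¬vs ∘ proj₁ ∘ proj₂)
  ...   | yes _  | no ¬vf = no (¬vf ∘ proj₂ ∘ proj₂)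

  inR⇒∈residuals : ∀ S K {H′} → T (inR S K H′) → H′ ∈ residuals S K
  inR⇒∈residuals S K t = Any.map (sym ∘ toWitness) (any⁻ _ (residuals S K) t)

  ∈residuals⇒inR : ∀ S K {H′} → H′ ∈ residuals S K → T (inR S K H′)
  ∈residuals⇒inR S K H′∈ = any⁺ _ (Any.map (fromWitness ∘ sym) H′∈)

  -- A query can always succeed.
  residual-exists : ∀ S K → ∃[ H′ ] H′ ∈ residuals S K
  residual-exists stop          K = K , here refl
  residual-exists (query e s f) K with H′ , H′∈ ← residual-exists s (afterSuccess e K) = H′ , ∈-++⁺ˡ H′∈

  height0-impossible : ∀ {K} (t : CDT K) → ¬ HeightAtMost 0 t
  height0-impossible leaf ()
  height0-impossible (node _ _ _) ()

  Option : Set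
  Option = Strategy × List SG

  Covers : SG → Option → Set
  Covers K (S , R) = ∀ H′ → T (inR S K H′) → H′ ∈ R

  module Trees (options : SG → List Option) where
    mutual
      trees : ℕ → (K : SG) → List (CDT K)
      trees zero    K = [ leaf ]
      trees (suc h) K = leaf ∷ concatMap (nodes h K) (options K)

      -- Children outside R are never reached, so the leaf default is harmless.
      nodes : ℕ → (K : SG) → Option → List (CDT K)
      nodes h K (S , R) with validFor? S K
      ... | yes v = map (λ ρ → node S v (λ H′ _ → lookupOr (λ _ → leaf) ρ H′)) (choices R (trees h))
      ... | no _  = []

    leaf∈trees : ∀ h K → leaf ∈ trees h K
    leaf∈trees zero    K = here refl
    leaf∈trees (suc h) K = here refl

    module _ {m b} (few : ∀ K → length (options K) ≤ m)
                   (small : ∀ K → All (λ o → length (proj₂ o) ≤ b) (options K)) where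
      mutual
        length-trees : ∀ h K → length (trees h K) ≤ treeBound m b h
        length-trees zero    K = ≤-refl
        length-trees (suc h) K = s≤s (begin
          length (concatMap (nodes h K) (options K))
            ≤⟨ length-concatMap-≤ _ (options K) (All.map (λ {o} → length-nodes h K {o}) (small K)) ⟩
          length (options K) * treeBound m b h ^ b   ≤⟨ *-monoˡ-≤ _ (few K) ⟩
          m * treeBound m b h ^ b                    ∎)
          where open ≤-Reasoning

        length-nodes : ∀ h K {o} → length (proj₂ o) ≤ b → length (nodes h K o) ≤ treeBound m b h ^ b
        length-nodes h K {S , R} R≤b with validFor? S K
        ... | no _  = z≤n
        ... | yes _ = begin
          length (map _ (choices R (trees h))) ≡⟨ LP.length-map _ (choices R (trees h)) ⟩
          length (choices R (trees h))         ≤⟨ length-choices R (trees h) (length-trees h) ⟩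
          treeBound m b h ^ length R           ≤⟨ ^-monoʳ-≤ _ {{treeBound-nonZero m b h}} R≤b ⟩
          treeBound m b h ^ b                  ∎
          where open ≤-Reasoning

    module _ {A : SG → Strategy → Set}
             (complete : ∀ K S → A K S → ∃[ R ] (S , R) ∈ options K × Covers K (S , R)) where
      mutual
        trees-complete : ∀ h K (t : CDT K) → HeightAtMost (suc h) t → AllNodes A t →
                         Any (t ≈T_) (trees h K)
        trees-complete zero    K leaf _ _ = here tt
        trees-complete (suc h) K leaf _ _ = here tt
        trees-complete zero    K (node S v ch) ht _ with H′ , H′∈ ← residual-exists S K =
          ⊥-elim (height0-impossible _ (ht H′ (∈residuals⇒inR S K H′∈)))
        trees-complete (suc h) K (node S v ch) ht (a , al) with complete K S a
        ... | R , o∈ , covers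
          with choices-complete (λ _ → leaf) R (trees h) (λ H′ u → ∀ p → ch H′ p ≈T u)
                                (λ H′ _ → children-enumerated h {K} {S} ch ht al H′)
        ...   | ρ , ρ∈ , agree = there (concatMap⁺ _ (Any.map (λ { refl → in-nodes }) o∈))
          where
          in-nodes : Any (node S v ch ≈T_) (nodes h K (S , R))
          in-nodes with validFor? S K
          ... | yes _ = map⁺ (lose ρ∈ (refl , λ H′ p _ → agree H′ (covers H′ p) p))
          ... | no ¬v = ⊥-elim (¬v v)

        children-enumerated : ∀ h {K S} (ch : (H′ : SG) → T (inR S K H′) → CDT H′) →
          (∀ H′ p → HeightAtMost (suc h) (ch H′ p)) → (∀ H′ p → AllNodes A (ch H′ p)) →
          ∀ H′ → ∃[ u ] u ∈ trees h H′ × (∀ p → ch H′ p ≈T u)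
        children-enumerated h {K} {S} ch ht al H′ with T? (inR S K H′)
        ... | no ¬p = leaf , leaf∈trees h H′ , λ p → ⊥-elim (¬p p)
        ... | yes p with u , u∈ , ≈u ← find (trees-complete h H′ (ch H′ p) (ht H′ p) (al H′ p)) =
          u , u∈ , λ p′ → subst (λ p″ → ch H′ p″ ≈T u) (T-irrelevant p p′) ≈u

module Deletion (G : Graph) where
  open Graph G
  open GraphNotions G
  open GraphFacts G

  deleting : (Fin nE → Bool) → SG → SG
  deleting r K = V K , tabulate (λ f → lookup (E K) f ∧ not (r f))

  deleting-cong : ∀ {r r′} K → (∀ f → T (lookup (E K) f) → r f ≡ r′ f) → deleting r K ≡ deleting r′ K
  deleting-cong {r} {r′} K r≡r′ = cong (V K ,_) (tabulate-cong agree)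
    where
    agree : ∀ f → lookup (E K) f ∧ not (r f) ≡ lookup (E K) f ∧ not (r′ f)
    agree f with lookup (E K) f in f∈K
    ... | true  = cong not (r≡r′ f (Equivalence.from T-≡ f∈K))
    ... | false = refl

  deleting-deleting : ∀ {r r′ r″} K → (∀ f → r f ∨ r′ f ≡ r″ f) →
                      deleting r′ (deleting r K) ≡ deleting r″ K
  deleting-deleting {r} {r′} {r″} K r∨r′≡r″ = cong (V K ,_) (tabulate-cong λ f → begin
    lookup (tabulate _) f ∧ not (r′ f)        ≡⟨ cong (_∧ not (r′ f)) (lookup∘tabulate _ f) ⟩
    (lookup (E K) f ∧ not (r f)) ∧ not (r′ f) ≡⟨ ∧-not-∨ (lookup (E K) f) (r f) (r′ f) ⟩
    lookup (E K) f ∧ not (r f ∨ r′ f)         ≡⟨ cong (λ b → lookup (E K) f ∧ not b) (r∨r′≡r″ f) ⟩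
    lookup (E K) f ∧ not (r″ f)               ∎)
    where open ≡-Reasoning

  deleting-nothing : ∀ K → K ≡ deleting (λ _ → false) K
  deleting-nothing K = cong (V K ,_)
    (sym (trans (tabulate-cong λ f → ∧-identityʳ (lookup (E K) f)) (tabulate∘lookup (E K))))

  _∈ᵇ_ : Fin nE → List (Fin nE) → Bool
  f ∈ᵇ fs = any (λ g → ⌊ f ≟F g ⌋) fs

  ∈⇒∈ᵇ : ∀ {f fs} → f ∈ fs → T (f ∈ᵇ fs)
  ∈⇒∈ᵇ f∈fs = any⁺ _ (Any.map (fromWitness {a? = _ ≟F _}) f∈fs)

  module Sequential (sure : Vec Bool nE) where
    open Outcomes sure

    removedBy : List (Fin nE) → List (Fin nE) → Fin nE → Bool
    removedBy fs S f = f ∈ᵇ fs ∨ any (λ g → shares g f) S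

    -- S lists the queries that succeeded.
    runSeq-residual : ∀ fs K {K″} → K″ ∈ residuals (runSeq fs K) K →
                      ∃[ S ] S ⊆ fs × K″ ≡ deleting (removedBy fs S) K
    runSeq-residual []       K (here refl) = [] , (λ ()) , deleting-nothing K
    runSeq-residual (g ∷ fs) K K″∈ with lookup (E K) g in g∈K
    ... | false with runSeq-residual fs K K″∈
    ...   | S , S⊆fs , K″≡ = S , there ∘ S⊆fs , trans K″≡ (deleting-cong K skipped)
      where
      skipped : ∀ f → T (lookup (E K) f) → removedBy fs S f ≡ removedBy (g ∷ fs) S f
      skipped f f∈K with f ≟F g
      ... | no _     = refl
      ... | yes refl with () ← trans (sym (Equivalence.to T-≡ f∈K)) g∈K
    runSeq-residual (g ∷ fs) K K″∈ | true
      with ∈-++⁻ (residuals (runSeq fs (afterSuccess g K)) (afterSuccess g K)) K″∈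
    ... | inj₁ K″∈ₛ with runSeq-residual fs (afterSuccess g K) K″∈ₛ
    ...   | S , S⊆fs , K″≡ = g ∷ S , ⊆-step , trans K″≡ (deleting-deleting K succeeded)
      where
      ⊆-step : g ∷ S ⊆ g ∷ fs
      ⊆-step (here refl) = here refl
      ⊆-step (there x∈S) = there (S⊆fs x∈S)
      succeeded : ∀ f → shares g f ∨ removedBy fs S f ≡ removedBy (g ∷ fs) (g ∷ S) f
      succeeded f with f ≟F g
      ... | yes refl rewrite shares-refl f = refl
      ... | no _     = ∨-swap (shares g f) (f ∈ᵇ fs) _
    runSeq-residual (g ∷ fs) K K″∈ | true | inj₂ K″∈f with lookup sure g
    runSeq-residual (g ∷ fs) K K″∈ | true | inj₂ () | true
    ... | false with runSeq-residual fs (afterFailure g K) K″∈f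
    ...   | S , S⊆fs , K″≡ = S , there ∘ S⊆fs , trans K″≡ (deleting-deleting K failed)
      where
      failed : ∀ f → ⌊ f ≟F g ⌋ ∨ removedBy fs S f ≡ removedBy (g ∷ fs) S f
      failed f = sym (∨-assoc ⌊ f ≟F g ⌋ (f ∈ᵇ fs) _)

module PathFacts (G : Graph) (p : GraphNotions.Path G) where
  open Graph G
  open GraphNotions G
  open GraphFacts G

  q : ℕ
  q = len p

  start end : Fin nV
  start = vert p fzero
  end   = vert p (fromℕ q)

  OffPath : Fin nE → Set
  OffPath f = ∀ k → f ≢ edge p k

  edge-injective : ∀ {j j′} → edge p j ≡ edge p j′ → j ≡ j′
  edge-injective {j} {j′} e≡e′
    with joins-unique (joins p j) (subst (λ e → Joins e _ _) (sym e≡e′) (joins p j′))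
  ... | inj₁ (x≡x′ , _)    = inject₁-injective (vinj p _ _ x≡x′)
  ... | inj₂ (x≡y′ , y≡x′) = ⊥-elim (<-asym j′<j j<j′)
    where
    j′<j : toℕ j′ < toℕ j
    j′<j = ≤-reflexive (trans (sym (cong toℕ (vinj p _ _ x≡y′))) (toℕ-inject₁ j))
    j<j′ : toℕ j < toℕ j′
    j<j′ = ≤-reflexive (trans (cong toℕ (vinj p _ _ y≡x′)) (toℕ-inject₁ j′))

  src-on-path : ∀ k → ∃[ m ] vert p m ≡ src (edge p k)
  src-on-path k with joins-src (joins p k)
  ... | inj₁ s≡x = inject₁ k , sym s≡x
  ... | inj₂ s≡y = fsuc k , sym s≡y

  module _ (noHigh : ∀ m → ¬ High (vert p m)) where

    -- An inner vertex already has its two path edges, so a third edge would make it high.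
    offPath-incident⇒end : ∀ {f} m → OffPath f → Incident f (vert p m) → m ≡ fzero ⊎ m ≡ fromℕ q
    offPath-incident⇒end fzero     _   _  = inj₁ refl
    offPath-incident⇒end (fsuc m′) off f∋ with q ≟ toℕ (fsuc m′)
    ... | yes q≡ = inj₂ (toℕ-injective (trans (sym q≡) (sym (toℕ-fromℕ q))))
    ... | no q≢  = ⊥-elim (noHigh (fsuc m′) (3≤degree a≢b (off m′ ∘ sym) (off k ∘ sym) a∋ b∋ f∋))
      where
      k : Fin q
      k = lower₁ (fsuc m′) q≢
      a∋ : Incident (edge p m′) (vert p (fsuc m′))
      a∋ = joins-incidentʳ (joins p m′)
      b∋ : Incident (edge p k) (vert p (fsuc m′))
      b∋ = subst (λ m → Incident (edge p k) (vert p m)) (inject₁-lower₁ (fsuc m′) q≢)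
                 (joins-incidentˡ (joins p k))
      a≢b : edge p m′ ≢ edge p k
      a≢b a≡b = <-irrefl (trans (sym (toℕ-inject₁ m′)) (cong toℕ m′↑≡)) (n<1+n (toℕ m′))
        where
        m′↑≡ : inject₁ m′ ≡ fsuc m′
        m′↑≡ = trans (cong inject₁ (edge-injective a≡b)) (inject₁-lower₁ (fsuc m′) q≢)

    pathEdge-meets-offPath-at-end : ∀ k {f v} → OffPath f →
      Incident (edge p k) v → Incident f v → v ≡ start ⊎ v ≡ end
    pathEdge-meets-offPath-at-end k off e∋ f∋ with joins-incident⁻ (joins p k) e∋
    ... | inj₁ refl = Sum.map (cong (vert p)) (cong (vert p)) (offPath-incident⇒end _ off f∋)
    ... | inj₂ refl = Sum.map (cong (vert p)) (cong (vert p)) (offPath-incident⇒end _ off f∋)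

    module _ (sure : Vec Bool nE) where
      open Outcomes sure
      open Deletion G
      open Sequential sure

      pathEdges : Fin q → List (Fin nE)
      pathEdges j = map (edge p) (pathOrder q j)

      pathOrder-complete : ∀ j k → k ∈ pathOrder q j
      pathOrder-complete j k with ∈-++⁻ (take (suc (toℕ j)) (allFin q)) k∈
        where
        k∈ : k ∈ take (suc (toℕ j)) (allFin q) ++ drop (suc (toℕ j)) (allFin q)
        k∈ = subst (k ∈_) (sym (LP.take++drop≡id (suc (toℕ j)) (allFin q))) (∈-allFin k)
      ... | inj₁ k∈taken   = ∈-++⁺ˡ (reverse⁺ k∈taken)
      ... | inj₂ k∈dropped = ∈-++⁺ʳ _ k∈dropped

      pathEdge∈ᵇpathEdges : ∀ j k → T (edge p k ∈ᵇ pathEdges j)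
      pathEdge∈ᵇpathEdges j k = ∈⇒∈ᵇ (∈-map⁺ (edge p) (pathOrder-complete j k))

      touches : Fin nE → Fin nV → Bool
      touches f v = ⌊ incident? v f ⌋

      touchedAt : List (Fin nE) → Fin nV → Bool
      touchedAt S v = any (λ g → touches g v) S

      -- b₀ (b₁) records whether some edge at the start (end) of p was matched.
      atEnds : Bool → Bool → Fin nE → Bool
      atEnds b₀ b₁ f = (b₀ ∧ touches f start) ∨ (b₁ ∧ touches f end)

      endCut : SG → Fin q → Bool → Bool → SG
      endCut K j b₀ b₁ = deleting (λ f → f ∈ᵇ pathEdges j ∨ atEnds b₀ b₁ f) K

      endCuts : SG → Fin q → List SG
      endCuts K j = endCut K j false false ∷ endCut K j false true ∷
                    endCut K j true false  ∷ endCut K j true true  ∷ []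

      endCut∈endCuts : ∀ K j b₀ b₁ → endCut K j b₀ b₁ ∈ endCuts K j
      endCut∈endCuts K j false false = here refl
      endCut∈endCuts K j false true  = there (here refl)
      endCut∈endCuts K j true  false = there (there (here refl))
      endCut∈endCuts K j true  true  = there (there (there (here refl)))

      shares-pathEdges≡at-ends : ∀ S {f} → All (λ g → ∃[ k ] g ≡ edge p k) S → OffPath f →
        any (λ g → shares g f) S ≡ atEnds (touchedAt S start) (touchedAt S end) f
      shares-pathEdges≡at-ends S {f} onPath off = T-injective to from
        where
        atStart : Bool
        atStart = touchedAt S start ∧ touches f start
        meet : ∀ {v} → Any (λ g → Incident g v) S → Incident f v → T (any (λ g → shares g f) S)
        meet g∋ f∋ with g , g∈S , g∋v ← find g∋ =
          any⁺ _ (lose g∈S (common-endpoint⇒shares g f g∋v f∋))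
        meetAt : ∀ v → T (touchedAt S v ∧ touches f v) → T (any (λ g → shares g f) S)
        meetAt v t with g∋ , f∋ ← Equivalence.to T-∧ t =
          meet (Any.map toWitness (any⁻ _ S g∋)) (toWitness f∋)
        touchAt : ∀ {g v} → g ∈ S → Incident g v → Incident f v → T (touchedAt S v ∧ touches f v)
        touchAt g∈S g∋ f∋ = Equivalence.from T-∧ (any⁺ _ (lose g∈S (fromWitness g∋)) , fromWitness f∋)
        to : T (any (λ g → shares g f) S) → T (atEnds (touchedAt S start) (touchedAt S end) f)
        to t with find (any⁻ _ S t)
        ... | g , g∈S , sh with shares⇒common-endpoint g f sh | All.lookup onPath g∈S
        ...   | v , g∋v , f∋v | k , refl =
          Equivalence.from (T-∨ {atStart})
            (Sum.map (λ { refl → touchAt g∈S g∋v f∋v }) (λ { refl → touchAt g∈S g∋v f∋v })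
                     (pathEdge-meets-offPath-at-end k off g∋v f∋v))
        from : T (atEnds (touchedAt S start) (touchedAt S end) f) → T (any (λ g → shares g f) S)
        from t = Sum.[ meetAt start , meetAt end ] (Equivalence.to (T-∨ {atStart}) t)

      pathStrategy-residual : ∀ K j {K″} → K″ ∈ residuals (pathStrategy K p j) K → K″ ∈ endCuts K j
      pathStrategy-residual K j K″∈ with S , S⊆ , K″≡ ← runSeq-residual (pathEdges j) K K″∈ =
        subst (_∈ endCuts K j) (sym (trans K″≡ (deleting-cong K λ f _ → ends f)))
              (endCut∈endCuts K j (touchedAt S start) (touchedAt S end))
        where
        onPath : All (λ g → ∃[ k ] g ≡ edge p k) S
        onPath = All.tabulate λ g∈S → map₂ proj₂ (∈-map⁻ (edge p) (S⊆ g∈S))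
        ends : ∀ f → removedBy (pathEdges j) S f ≡
                     f ∈ᵇ pathEdges j ∨ atEnds (touchedAt S start) (touchedAt S end) f
        ends f with f ∈ᵇ pathEdges j in f∉
        ... | true  = refl
        ... | false = shares-pathEdges≡at-ends S onPath off
          where
          off : OffPath f
          off k refl with () ← trans (sym (Equivalence.to T-≡ (pathEdge∈ᵇpathEdges j k))) f∉

module AllowedMenu (G : Graph) (sure : Vec Bool (Graph.nE G))
                   (w : ℕ) (P : Fin w → GraphNotions.Path G)
                   (components : GraphNotions.IsComponentPaths G w P) where
  open Graph G
  open GraphNotions G
  open Outcomes sure
  open Enumeration G sure
  module PF (i : Fin w) = PathFacts G (P i)

  noHigh : ∀ i m → ¬ High (vert (P i) m)
  noHigh = proj₁ components

  disjoint : ∀ i i′ m m′ → vert (P i) m ≡ vert (P i′) m′ → i ≡ i′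
  disjoint = proj₁ (proj₂ (proj₂ components))

  Position : Set
  Position = Σ (Fin w) (λ i → Fin (len (P i)))

  position-unique : ∀ {i j i′ j′} → edge (P i) j ≡ edge (P i′) j′ →
                    _≡_ {A = Position} (i , j) (i′ , j′)
  position-unique {i} {j} {i′} {j′} e≡e′
    with m , m↦ ← PF.src-on-path i j | m′ , m′↦ ← PF.src-on-path i′ j′
    with refl ← disjoint i i′ m m′ (trans m↦ (trans (cong src e≡e′) (sym m′↦)))
    = cong (i ,_) (PF.edge-injective i e≡e′)

  pathPosition? : ∀ e → Dec (∃[ i ] ∃[ j ] edge (P i) j ≡ e)
  pathPosition? e = any? λ i → any? λ j → edge (P i) j ≟F e

  queryOption : SG → Fin nE → Option
  queryOption K e = query e stop stop , afterSuccess e K ∷ afterFailure e K ∷ []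

  pathOption : SG → Fin nE → Maybe Option
  pathOption K e with pathPosition? e
  ... | yes (i , j , _) = just (pathStrategy K (P i) j , PF.endCuts i (noHigh i) sure K j)
  ... | no _            = nothing

  options : SG → List Option
  options K = map (queryOption K) (allFin nE) ++ mapMaybe (pathOption K) (allFin nE)

  length-options : ∀ K → length (options K) ≤ nE + nE
  length-options K = begin
    length (options K)
      ≡⟨ LP.length-++ (map (queryOption K) (allFin nE)) ⟩
    length (map _ (allFin nE)) + length (mapMaybe _ (allFin nE))
      ≤⟨ +-mono-≤ (≤-reflexive (LP.length-map _ (allFin nE)))
                  (LP.length-mapMaybe (pathOption K) (allFin nE)) ⟩
    length (allFin nE) + length (allFin nE)
      ≡⟨ cong₂ _+_ length-allFin length-allFin ⟩
    nE + nE
      ∎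
    where
    open ≤-Reasoning
    length-allFin : length (allFin nE) ≡ nE
    length-allFin = LP.length-tabulate id

  options-small : ∀ K → All (λ o → length (proj₂ o) ≤ 4) (options K)
  options-small K = All.++⁺ (All.map⁺ (All.universal (λ _ → s≤s (s≤s z≤n)) (allFin nE)))
                            (All.mapMaybe⁺ (All.map⁺ (All.universal pathOption-small (allFin nE))))
    where
    pathOption-small : ∀ e → Maybe.All (λ o → length (proj₂ o) ≤ 4) (pathOption K e)
    pathOption-small e with pathPosition? e
    ... | yes _ = Maybe.All.just ≤-refl
    ... | no _  = Maybe.All.nothing

  query-covers : ∀ K e {H′} → H′ ∈ residuals (query e stop stop) K →
                 H′ ∈ afterSuccess e K ∷ afterFailure e K ∷ []
  query-covers K e (here refl) = here refl
  query-covers K e (there H′∈) with lookup sure e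
  query-covers K e (there H′∈) | false = there H′∈
  query-covers K e (there ())  | true

  pathOption-found : ∀ K i j →
    Maybe.Any ((pathStrategy K (P i) j , PF.endCuts i (noHigh i) sure K j) ≡_) (pathOption K (edge (P i) j))
  pathOption-found K i j with pathPosition? (edge (P i) j)
  ... | yes (_ , _ , e≡) with refl ← position-unique e≡ = Maybe.Any.just refl
  ... | no none = ⊥-elim (none (i , j , refl))

  options-complete : ∀ K S → AllowedStrategy w P K S → ∃[ R ] (S , R) ∈ options K × Covers K (S , R)
  options-complete K _ (inj₁ (e , _ , _ , _ , _ , _ , refl)) =
    _ , ∈-++⁺ˡ (∈-map⁺ (queryOption K) (∈-allFin e)) ,
    λ H′ t → query-covers K e (inR⇒∈residuals (query e stop stop) K t)
  options-complete K _ (inj₂ (i , j , _ , refl)) =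
    _ , ∈-++⁺ʳ _ (mapMaybe⁺ (pathOption K) (allFin nE)
                   (map⁺ (lose (∈-allFin (edge (P i) j)) (pathOption-found K i j)))) ,
    λ H′ t → PF.pathStrategy-residual i (noHigh i) sure K j (inR⇒∈residuals (pathStrategy K (P i) j) K t)

lemma5 : (d : ℕ) (G : Graph) →
    let open Graph G in
    let open GraphNotions G in
    Connected → NoPendantEdges → nE ≤ nV + d → 1 ≤ nE →
    (w : ℕ) (P : Fin w → Path) → IsComponentPaths w P →
    (sure : Vec Bool nE) →
    let open Outcomes sure in
    (H : SG) → IsSubgraph H →
    ∃[ L ] (length L ≤ nE ^ (4 ^ (9 * d + 1)))
      × ((t : CDT H) → HeightAtMost (9 * d + 1) t → DistinctAlongPaths [] t →
           AllNodes (AllowedStrategy w P) t → Any (t ≈T_) L)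
lemma5 d G _ noPendant _ 1≤nE w P components sure H _ =
  trees (9 * d) H , length-bound , λ t height _ allowed →
    trees-complete options-complete (9 * d) H t (subst (λ h → HeightAtMost h t) (+-comm (9 * d) 1) height)
                   allowed
  where
  open Graph G
  open GraphNotions G
  open Outcomes sure
  open Enumeration G sure
  open AllowedMenu G sure w P components
  open Trees options
  instance
    nE≢0 : NonZero nE
    nE≢0 = >-nonZero 1≤nE
  length-bound : length (trees (9 * d) H) ≤ nE ^ (4 ^ (9 * d + 1))
  length-bound = begin
    length (trees (9 * d) H)      ≤⟨ length-trees length-options options-small (9 * d) H ⟩
    treeBound (nE + nE) 4 (9 * d) ≤⟨ treeBound≤ (GraphFacts.2≤nE G noPendant 1≤nE) (9 * d) ⟩
    nE ^ exponent (9 * d)         ≤⟨ ^-monoʳ-≤ nE exponent≤ ⟩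
    nE ^ (4 ^ (9 * d + 1))        ∎
    where
    open ≤-Reasoning
    exponent≤ : exponent (9 * d) ≤ 4 ^ (9 * d + 1)
    exponent≤ = <⇒≤ (<-≤-trans (exponent<4^ (9 * d)) (^-monoʳ-≤ 4 (m≤m+n (9 * d) 1)))
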